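{- For every integer $k \geq 3$, there are infinitely many $k$-dicritical digraphs that contain no directed path on $3k+1$ vertices.
   Context: Digraphs are finite, without loops or parallel arcs (two opposite arcs $uv, vu$, forming a digon, are allowed). A $k$-dicolouring of a digraph $D$ is a map $V(D)\to\{1,\dots,k\}$ such that every colour class induces an acyclic subdigraph (i.e. no directed cycle is monochromatic). The dichromatic number $\vec{\chi}(D)$ is the least $k$ such that $D$ has a $k$-dicolouring. A digraph $D$ is $k$-dicritical if $\vec{\chi}(D)=k$ and every proper subdigraph $H$ of $D$ satisfies $\vec{\chi}(H)<k$. A directed path on $n$ vertices is a subdigraph with vertices $u_1,\dots,u_n$ and arcs $u_iu_{i+1}$, $1\le i<n$. -}

module Defs where

open import Data.Nat using (ℕ; zero; suc; _<_; _≥_; _*_; _+_)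
open import Data.Fin using (Fin; zero; suc; inject₁; fromℕ)
open import Data.Unit using (⊤)
open import Data.Bool using (Bool; true; false)
open import Data.Product using (Σ; ∃; ∃-syntax; _×_; _,_)
open import Relation.Binary.PropositionalEquality using (_≡_)
open import Relation.Nullary using (¬_)
open import Function.Definitions using (Injective)

-- A finite digraph on vertex set Fin n; arc u v ≡ true means uv is an arc.
-- No loops; parallel arcs are impossible by construction; digons allowed.
record Digraph : Set where
  field
    n        : ℕ
    arc      : Fin n → Fin n → Bool
    loopless : ∀ v → arc v v ≡ false
open Digraph public

record SubDigraph (D : Digraph) : Set where
  field
    vtx     : Fin (n D) → Bool
    harc    : Fin (n D) → Fin (n D) → Bool
    harc⊆   : ∀ u v → harc u v ≡ true → arc D u v ≡ true
    harc-ends : ∀ u v → harc u v ≡ true → (vtx u ≡ true) × (vtx v ≡ true)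
open SubDigraph public

whole : (D : Digraph) → SubDigraph D
whole D = record
  { vtx = λ _ → true ; harc = arc D ; harc⊆ = λ _ _ p → p
  ; harc-ends = λ _ _ _ → _≡_.refl , _≡_.refl }

Proper : {D : Digraph} → SubDigraph D → Set
Proper {D} H = (∃[ v ] vtx H v ≡ false) Data.Sum.⊎
               (∃[ u ] ∃[ v ] (arc D u v ≡ true × harc H u v ≡ false))
  where import Data.Sum

-- A directed cycle (on m+2 ≥ 2 distinct vertices) in the subdigraph H:
-- c 0 → c 1 → … → c (m+1) → c 0, all vertices in H and all arcs arcs of H.
record Cycle {D : Digraph} (H : SubDigraph D) : Set where
  field
    len-2  : ℕ
    cyc    : Fin (suc (suc len-2)) → Fin (n D)
    inj    : Injective _≡_ _≡_ cyc
    invtx  : ∀ i → vtx H (cyc i) ≡ true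
    steps  : ∀ (i : Fin (suc len-2)) → harc H (cyc (inject₁ i)) (cyc (suc i)) ≡ true
    close  : harc H (cyc (fromℕ (suc len-2))) (cyc zero) ≡ true
open Cycle public

V : {D : Digraph} → SubDigraph D → Set
V {D} H = Σ (Fin (n D)) (λ v → vtx H v ≡ true)

IsDicolouring : {D : Digraph} (H : SubDigraph D) (j : ℕ) → (V H → Fin j) → Set
IsDicolouring H j col =
  (C : Cycle H) →
  ¬ (∀ i → col (cyc C i , invtx C i) ≡ col (cyc C zero , invtx C zero))

Dicolourable : {D : Digraph} → SubDigraph D → ℕ → Set
Dicolourable H j = ∃[ col ] IsDicolouring H j col

DichromaticNumber≡ : {D : Digraph} → SubDigraph D → ℕ → Set
DichromaticNumber≡ H k = Dicolourable H k × (∀ j → j < k → ¬ Dicolourable H j)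

DichromaticNumber< : {D : Digraph} → SubDigraph D → ℕ → Set
DichromaticNumber< H k = ∃[ j ] (j < k × Dicolourable H j)

Dicritical : ℕ → Digraph → Set
Dicritical k D = DichromaticNumber≡ (whole D) k ×
                 ((H : SubDigraph D) → Proper H → DichromaticNumber< H k)

HasDirectedPath : ℕ → Digraph → Set
HasDirectedPath zero D = ⊤
HasDirectedPath (suc m) D =
  ∃[ p ] (Injective _≡_ _≡_ p ×
          (∀ (i : Fin m) → arc D (p (inject₁ i)) (p (suc i)) ≡ true))

{-# OPTIONS --safe #-}
module Submission where

-- Take k − 1 hubs forming a bidirected complete digraph and a spine s₀ … s_ℓ, ℓ odd and as large as
-- we like, oriented as an antidirected path: each spine arc goes from an even position to an adjacent
-- odd one. The hubs h₂, h₃, … form digons with all spine vertices; the low hubs h₀ and h₁ send arcs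
-- to the even and receive arcs from the odd spine vertices, and h₁ also forms digons with s₀ and s_ℓ.
-- Giving the spine a k-th colour is a k-dicolouring. With k − 1 colours the hubs use them all, so
-- each sᵢ has the colour of h₀ or h₁; a spine arc and a low hub form a directed triangle, so the
-- colours alternate from h₀'s at s₀ to h₁'s at s_ℓ, contradicting the digon s_ℓ h₁. After deleting
-- a spine arc, alternating along the spine but swapping the alternation at that arc is a
-- (k − 1)-dicolouring; after deleting an arc between a hub t and sᵢ, the same colouring swapped at sᵢ
-- with sᵢ recoloured like t is one; after deleting a hub arc st, colour the spine like t and t like s.
-- The spine has no directed path on three vertices, so any three consecutive vertices of a directed
-- path contain a hub, and directed paths have at most 3k − 1 vertices.

open import Defs
open import Data.Nat using (ℕ; _≥_; _>_; _*_; _+_)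
open import Data.Product using (Σ; ∃-syntax; _×_)
open import Relation.Nullary using (¬_)

open import Data.Nat as ℕ using (zero; suc; _≤_; _<_; z≤n; s≤s; parity)
open import Data.Nat.Properties
  using (≤-refl; ≤-trans; <⇒≤; <-irrefl; <-≤-trans; +-suc; suc-injective; 1+n≢n;
         m≤m+n; m≤n+m; n≤1+n;
         ≤-reflexive; n≮n; 1+n≢0; ≤-pred; *-comm)
open import Data.Fin as Fin using (Fin; zero; suc; toℕ; inject₁; inject≤; fromℕ; combine)
open import Data.Fin.Properties
  using (+↔⊎; toℕ-injective; toℕ-inject₁; toℕ-inject≤; toℕ-combine; inject≤-injective;
         combine-injectiveˡ; injective⇒≤;
         inject₁-injective; fromℕ≢inject₁; toℕ≤pred[n]; toℕ-fromℕ; pigeonhole; <⇒≢; 0≢1+n)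
open import Data.Fin.Induction using (<-weakInduction)
open import Data.Bool using (true; false; if_then_else_)
open import Data.Bool.Properties using (¬-not; not-¬)
open import Data.Empty using (⊥; ⊥-elim)
open import Data.Unit using (⊤)
open import Data.Product as Product using (_,_; proj₁; proj₂; ∃₂)
open import Data.Sum as Sum using (_⊎_; inj₁; inj₂)
open import Data.Sum.Properties using (≡-dec)
open import Data.Parity.Base as ℙ using (Parity; 0ℙ; 1ℙ; _⁻¹)
import Data.Parity.Properties as ℙ
open import Function using (_∘_; id)
open import Function.Bundles using (_↔_; Inverse)
open import Function.Definitions using (Injective)
open import Relation.Binary.Definitions using (DecidableEquality; Decidable)
open import Relation.Nullary using (yes; no; does; ¬?; _×-dec_; _⊎-dec_)
open import Relation.Nullary.Decidable using (dec-true; dec-false; map′)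
open import Relation.Binary.PropositionalEquality
  using (_≡_; _≢_; refl; sym; trans; cong; subst; subst₂; module ≡-Reasoning)

strictlyIncreasing⇒head≤ : ∀ {l} (g : Fin (suc l) → ℕ) →
  (∀ i → g (inject₁ i) < g (suc i)) → ∀ i → g zero ≤ g i
strictlyIncreasing⇒head≤ g step zero = ≤-refl
strictlyIncreasing⇒head≤ {suc l} g step (suc i) =
  ≤-trans (strictlyIncreasing⇒head≤ (g ∘ inject₁) (step ∘ inject₁) i) (<⇒≤ (step i))

module _ {D : Digraph} where

  ranked⇒isDicolouring : (H : SubDigraph D) {j : ℕ} (col : Fin (n D) → Fin j) (r : Fin (n D) → ℕ) →
    (∀ {u v} → harc H u v ≡ true → col u ≡ col v → r u < r v) → IsDicolouring H j (col ∘ proj₁)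
  ranked⇒isDicolouring H col r ranked C mono =
    <-irrefl refl (<-≤-trans closing (strictlyIncreasing⇒head≤ (r ∘ cyc C) step (fromℕ _)))
    where
    step : ∀ i → r (cyc C (inject₁ i)) < r (cyc C (suc i))
    step i = ranked (steps C i) (trans (mono (inject₁ i)) (sym (mono (suc i))))
    closing : r (cyc C (fromℕ (suc (len-2 C)))) < r (cyc C zero)
    closing = ranked (close C) (mono _)

  proper⇒missing-arc : (H : SubDigraph D) →
    (∀ v → ∃[ u ] (arc D v u ≡ true ⊎ arc D u v ≡ true)) →
    Proper H → ∃[ u ] ∃[ v ] (arc D u v ≡ true × harc H u v ≡ false)
  proper⇒missing-arc H incident (inj₂ missing) = missing
  proper⇒missing-arc H incident (inj₁ (v , v∉H)) = around (incident v)
    where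
    v∉ : vtx H v ≢ true
    v∉ v∈ with () ← trans (sym v∈) v∉H
    around : ∃[ u ] (arc D v u ≡ true ⊎ arc D u v ≡ true) →
             ∃[ u ] ∃[ w ] (arc D u w ≡ true × harc H u w ≡ false)
    around (u , inj₁ vu) = v , u , vu , ¬-not (v∉ ∘ proj₁ ∘ harc-ends H v u)
    around (u , inj₂ uv) = u , v , uv , ¬-not (v∉ ∘ proj₂ ∘ harc-ends H u v)

  arc⇒≢ : ∀ {u v} → arc D u v ≡ true → u ≢ v
  arc⇒≢ {u} uv refl with () ← trans (sym uv) (loopless D u)

  module _ {j : ℕ} (dicolourable : Dicolourable (whole D) j) where

    colourOf : Fin (n D) → Fin j
    colourOf u = proj₁ dicolourable (u , refl)

    digon-colours-differ : ∀ {u v} → arc D u v ≡ true → arc D v u ≡ true → colourOf u ≢ colourOf v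
    digon-colours-differ {u} {v} uv vu same =
      proj₂ dicolourable digon λ { zero → refl ; (suc zero) → sym same }
      where
      cycle : Fin 2 → Fin (n D)
      cycle zero = u
      cycle (suc zero) = v
      cycle-injective : Injective _≡_ _≡_ cycle
      cycle-injective {zero} {zero} _ = refl
      cycle-injective {zero} {suc zero} u≡v = ⊥-elim (arc⇒≢ uv u≡v)
      cycle-injective {suc zero} {zero} v≡u = ⊥-elim (arc⇒≢ vu v≡u)
      cycle-injective {suc zero} {suc zero} _ = refl
      digon : Cycle (whole D)
      digon = record { len-2 = 0 ; cyc = cycle ; inj = cycle-injective ; invtx = λ _ → refl
                     ; steps = λ { zero → uv } ; close = vu }

    triangle-not-monochromatic : ∀ {u v w} → arc D u v ≡ true → arc D v w ≡ true → arc D w u ≡ true →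
      colourOf u ≡ colourOf v → colourOf v ≡ colourOf w → ⊥
    triangle-not-monochromatic {u} {v} {w} uv vw wu u~v v~w =
      proj₂ dicolourable triangle
        λ { zero → refl ; (suc zero) → sym u~v ; (suc (suc zero)) → sym (trans u~v v~w) }
      where
      cycle : Fin 3 → Fin (n D)
      cycle zero = u
      cycle (suc zero) = v
      cycle (suc (suc zero)) = w
      cycle-injective : Injective _≡_ _≡_ cycle
      cycle-injective {zero} {zero} _ = refl
      cycle-injective {zero} {suc zero} u≡v = ⊥-elim (arc⇒≢ uv u≡v)
      cycle-injective {zero} {suc (suc zero)} u≡w = ⊥-elim (arc⇒≢ wu (sym u≡w))
      cycle-injective {suc zero} {zero} v≡u = ⊥-elim (arc⇒≢ uv (sym v≡u))
      cycle-injective {suc zero} {suc zero} _ = refl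
      cycle-injective {suc zero} {suc (suc zero)} v≡w = ⊥-elim (arc⇒≢ vw v≡w)
      cycle-injective {suc (suc zero)} {zero} w≡u = ⊥-elim (arc⇒≢ wu w≡u)
      cycle-injective {suc (suc zero)} {suc zero} w≡v = ⊥-elim (arc⇒≢ vw (sym w≡v))
      cycle-injective {suc (suc zero)} {suc (suc zero)} _ = refl
      triangle : Cycle (whole D)
      triangle = record { len-2 = 1 ; cyc = cycle ; inj = cycle-injective ; invtx = λ _ → refl
                        ; steps = λ { zero → uv ; (suc zero) → vw } ; close = wu }

-- Split the first 3(h + 1) vertices of the path into h + 1 blocks of three consecutive vertices:
-- each block contains a vertex of S, and distinct blocks give distinct vertices of S.
no-long-path : (D : Digraph) {h : ℕ} (S : Fin h → Fin (n D)) →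
  (∀ {u v w} → arc D u v ≡ true → arc D v w ≡ true → ∃[ t ] (S t ≡ u ⊎ S t ≡ v ⊎ S t ≡ w)) →
  ∀ {m} → suc h * 3 ≤ m → ¬ HasDirectedPath m D
no-long-path D {h} S meets {suc m} bound (p , p-injective , path) =
  <-irrefl refl (injective⇒≤ hubOf-injective)
  where
  open ≡-Reasoning

  position : Fin (suc h) → Fin 3 → Fin (suc m)
  position b r = inject≤ (combine b r) bound

  consecutive : ∀ {x y} → suc (toℕ x) ≡ toℕ y → arc D (p x) (p y) ≡ true
  consecutive {x} {suc i} e =
    subst (λ z → arc D (p z) (p (suc i)) ≡ true)
          (toℕ-injective (trans (toℕ-inject₁ i) (sym (suc-injective e)))) (path i)

  next-in-block : ∀ b (r : Fin 2) → suc (toℕ (position b (inject₁ r))) ≡ toℕ (position b (suc r))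
  next-in-block b r = begin
    suc (toℕ (position b (inject₁ r))) ≡⟨ cong suc (toℕ-inject≤ _ bound) ⟩
    suc (toℕ (combine b (inject₁ r)))  ≡⟨ cong suc (toℕ-combine b (inject₁ r)) ⟩
    suc (3 * toℕ b + toℕ (inject₁ r))  ≡⟨ cong (λ x → suc (3 * toℕ b + x)) (toℕ-inject₁ r) ⟩
    suc (3 * toℕ b + toℕ r)            ≡⟨ sym (+-suc (3 * toℕ b) (toℕ r)) ⟩
    3 * toℕ b + toℕ (suc r)            ≡⟨ sym (toℕ-combine b (suc r)) ⟩
    toℕ (combine b (suc r))            ≡⟨ sym (toℕ-inject≤ _ bound) ⟩
    toℕ (position b (suc r))           ∎

  hubIn : ∀ b → ∃₂ λ t r → S t ≡ p (position b r)
  hubIn b with meets (consecutive (next-in-block b zero)) (consecutive (next-in-block b (suc zero)))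
  ... | t , inj₁ first = t , zero , first
  ... | t , inj₂ (inj₁ second) = t , suc zero , second
  ... | t , inj₂ (inj₂ third) = t , suc (suc zero) , third

  hubOf-injective : Injective _≡_ _≡_ (proj₁ ∘ hubIn)
  hubOf-injective {b} {b′} same with hubIn b | hubIn b′
  ... | t , r , at | t′ , r′ , at′ =
    combine-injectiveˡ b r b′ r′
      (inject≤-injective bound bound _ _ (p-injective (trans (sym at) (trans (cong S same) at′))))

module Ranking {A : Set} (_⇒_ : A → A → Set) where

  Ranked : {C : Set} → (A → A → Set) → (A → C) → (A → ℕ) → Set
  Ranked Allowed col r = ∀ {x y} → x ⇒ y → Allowed x y → col x ≡ col y → r x < r y

  Avoiding : A → A → A → Set
  Avoiding z x y = x ≢ z × y ≢ z

  OtherThan : A → A → A → A → Set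
  OtherThan p q x y = ¬ (x ≡ p × y ≡ q)

  module Recolouring (_≟_ : DecidableEquality A) (⇒-irrefl : ∀ {x} → ¬ x ⇒ x) where

    _[_≔_] : {B : Set} → (A → B) → A → B → A → B
    (f [ z ≔ b ]) x = if does (x ≟ z) then b else f x

    -- z becomes a source of its new colour class: only the arc w → z could enter it.
    recolour-source : ∀ {C} {col : A → C} {r : A → ℕ} {z w : A} {t : C} →
      Ranked (Avoiding z) col r → (∀ {x} → x ⇒ z → x ≢ w → col x ≢ t) →
      Ranked (OtherThan w z) (col [ z ≔ t ]) ((suc ∘ r) [ z ≔ 0 ])
    recolour-source {z = z} ranked fresh {x} {y} x⇒y other same with x ≟ z | y ≟ z
    ... | yes refl | yes refl = ⊥-elim (⇒-irrefl x⇒y)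
    ... | yes refl | no _     = s≤s z≤n
    ... | no _     | yes refl = ⊥-elim (fresh x⇒y (λ x≡w → other (x≡w , refl)) same)
    ... | no x≢z   | no y≢z   = s≤s (ranked x⇒y (x≢z , y≢z) same)

    recolour-sink : ∀ {C} {col : A → C} {r : A → ℕ} {z w : A} {t : C} {top : ℕ} →
      Ranked (Avoiding z) col r → (∀ x → r x < top) → (∀ {y} → z ⇒ y → y ≢ w → col y ≢ t) →
      Ranked (OtherThan z w) (col [ z ≔ t ]) (r [ z ≔ top ])
    recolour-sink {z = z} ranked below fresh {x} {y} x⇒y other same with x ≟ z | y ≟ z
    ... | yes refl | yes refl = ⊥-elim (⇒-irrefl x⇒y)
    ... | no _     | yes refl = below x
    ... | yes refl | no _     = ⊥-elim (fresh x⇒y (λ y≡w → other (refl , y≡w)) (sym same))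
    ... | no x≢z   | no y≢z   = ranked x⇒y (x≢z , y≢z) same

module Presentation {A : Set} {size : ℕ} (enumeration : Fin size ↔ A)
    {_⇒_ : A → A → Set} (_⇒?_ : Decidable _⇒_) (⇒-irrefl : ∀ {x} → ¬ x ⇒ x) where

  open Inverse enumeration using (to; from; strictlyInverseˡ; strictlyInverseʳ)
  open Ranking _⇒_

  digraph : Digraph
  digraph = record
    { n = size
    ; arc = λ u v → does (to u ⇒? to v)
    ; loopless = λ u → dec-false (to u ⇒? to u) ⇒-irrefl
    }

  arc⇒ : ∀ {u v} → arc digraph u v ≡ true → to u ⇒ to v
  arc⇒ {u} {v} uv with to u ⇒? to v | uv
  ... | yes u⇒v | _ = u⇒v

  ⇒arc : ∀ {x y} → x ⇒ y → arc digraph (from x) (from y) ≡ true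
  ⇒arc {x} {y} x⇒y =
    dec-true (to (from x) ⇒? to (from y))
      (subst₂ _⇒_ (sym (strictlyInverseˡ x)) (sym (strictlyInverseˡ y)) x⇒y)

  ranked⇒dicolourable : (H : SubDigraph digraph) {j : ℕ} {col : A → Fin j} {r : A → ℕ} →
    Ranked (λ x y → harc H (from x) (from y) ≡ true) col r → Dicolourable H j
  ranked⇒dicolourable H {col = col} {r} ranked =
    col ∘ to ∘ proj₁ ,
    ranked⇒isDicolouring H (col ∘ to) (r ∘ to) λ {u} {v} uv∈H →
      ranked (arc⇒ (harc⊆ H u v uv∈H))
             (subst₂ (λ u v → harc H u v ≡ true) (sym (strictlyInverseʳ u)) (sym (strictlyInverseʳ v)) uv∈H)

  rankedOtherThan⇒dicolourable : (H : SubDigraph digraph) {p q : A} → harc H (from p) (from q) ≡ false →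
    {j : ℕ} {col : A → Fin j} {r : A → ℕ} → Ranked (OtherThan p q) col r → Dicolourable H j
  rankedOtherThan⇒dicolourable H pq∉H ranked =
    ranked⇒dicolourable H λ x⇒y xy∈H → ranked x⇒y λ { (refl , refl) → not-¬ xy∈H pq∉H }

  incident : (∀ x → ∃[ y ] (x ⇒ y ⊎ y ⇒ x)) →
    ∀ u → ∃[ v ] (arc digraph u v ≡ true ⊎ arc digraph v u ≡ true)
  incident on-an-arc u with on-an-arc (to u)
  ... | y , inj₁ u⇒y =
    from y , inj₁ (subst (λ u → arc digraph u (from y) ≡ true) (strictlyInverseʳ u) (⇒arc u⇒y))
  ... | y , inj₂ y⇒u =
    from y , inj₂ (subst (λ u → arc digraph (from y) u ≡ true) (strictlyInverseʳ u) (⇒arc y⇒u))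

  proper⇒missing-⇒ : (∀ x → ∃[ y ] (x ⇒ y ⊎ y ⇒ x)) → (H : SubDigraph digraph) → Proper H →
    ∃[ p ] ∃[ q ] (p ⇒ q × harc H (from p) (from q) ≡ false)
  proper⇒missing-⇒ on-an-arc H proper
    with u , v , uv , uv∉H ← proper⇒missing-arc H (incident on-an-arc) proper =
    to u , to v , arc⇒ uv ,
    subst₂ (λ u v → harc H u v ≡ false) (sym (strictlyInverseʳ u)) (sym (strictlyInverseʳ v)) uv∉H

  ⇒-no-long-path : {h : ℕ} (S : Fin h → A) →
    (∀ {x y z} → x ⇒ y → y ⇒ z → ∃[ t ] (S t ≡ x ⊎ S t ≡ y ⊎ S t ≡ z)) →
    ∀ {m} → suc h * 3 ≤ m → ¬ HasDirectedPath m digraph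
  ⇒-no-long-path S meets = no-long-path digraph (from ∘ S) λ uv vw →
    Product.map₂ (Sum.map found (Sum.map found found)) (meets (arc⇒ uv) (arc⇒ vw))
    where
    found : ∀ {t u} → S t ≡ to u → from (S t) ≡ u
    found St≡u = trans (cong from St≡u) (strictlyInverseʳ _)

module Construction (a m : ℕ) where

  h : ℕ
  h = suc (suc a)

  last : ℕ
  last = suc (2 * m)

  Vertex : Set
  Vertex = Fin h ⊎ Fin (suc last)

  pattern hub t = inj₁ t
  pattern spine j = inj₂ j
  pattern h₀ = hub zero
  pattern h₁ = hub (suc zero)
  pattern high t = hub (suc (suc t))

  low : Parity → Fin h
  low 0ℙ = zero
  low 1ℙ = suc zero

  data Low : Fin h → Set where
    low₀ : Low zero
    low₁ : Low (suc zero)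

  Low-low : ∀ p → Low (low p)
  Low-low 0ℙ = low₀
  Low-low 1ℙ = low₁

  Even Odd : Fin (suc last) → Set
  Even j = parity (toℕ j) ≡ 0ℙ
  Odd j = parity (toℕ j) ≡ 1ℙ

  Adjacent : ℕ → ℕ → Set
  Adjacent x y = y ≡ suc x ⊎ x ≡ suc y

  infix 4 _⇒_

  data _⇒_ : Vertex → Vertex → Set where
    hub→hub    : ∀ {s t} → s ≢ t → hub s ⇒ hub t
    low→even   : ∀ {t j} → Low t → Even j → hub t ⇒ spine j
    odd→low    : ∀ {t j} → Low t → Odd j → spine j ⇒ hub t
    h₁→last    : ∀ {j} → toℕ j ≡ last → h₁ ⇒ spine j
    first→h₁   : ∀ {j} → toℕ j ≡ 0 → spine j ⇒ h₁
    high→spine : ∀ {t j} → high t ⇒ spine j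
    spine→high : ∀ {t j} → spine j ⇒ high t
    even→odd   : ∀ {i j} → Even i → Adjacent (toℕ i) (toℕ j) → spine i ⇒ spine j

  _⇒?_ : Decidable _⇒_
  hub s ⇒? hub t = map′ hub→hub (λ { (hub→hub s≢t) → s≢t }) (¬? (s Fin.≟ t))
  h₀ ⇒? spine j = map′ (low→even low₀) (λ { (low→even _ e) → e }) (parity (toℕ j) ℙ.≟ 0ℙ)
  h₁ ⇒? spine j =
    map′ Sum.[ low→even low₁ , h₁→last ]′ (λ { (low→even _ e) → inj₁ e ; (h₁→last l) → inj₂ l })
         (parity (toℕ j) ℙ.≟ 0ℙ ⊎-dec toℕ j ℕ.≟ last)
  high t ⇒? spine j = yes high→spine
  spine j ⇒? h₀ = map′ (odd→low low₀) (λ { (odd→low _ o) → o }) (parity (toℕ j) ℙ.≟ 1ℙ)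
  spine j ⇒? h₁ =
    map′ Sum.[ odd→low low₁ , first→h₁ ]′ (λ { (odd→low _ o) → inj₁ o ; (first→h₁ f) → inj₂ f })
         (parity (toℕ j) ℙ.≟ 1ℙ ⊎-dec toℕ j ℕ.≟ 0)
  spine j ⇒? high t = yes spine→high
  spine i ⇒? spine j =
    map′ (Product.uncurry even→odd) (λ { (even→odd e adj) → e , adj })
         (parity (toℕ i) ℙ.≟ 0ℙ ×-dec (toℕ j ℕ.≟ suc (toℕ i) ⊎-dec toℕ i ℕ.≟ suc (toℕ j)))

  ⇒-irrefl : ∀ {x} → ¬ x ⇒ x
  ⇒-irrefl (hub→hub t≢t) = t≢t refl
  ⇒-irrefl (even→odd _ (inj₁ j≡1+j)) = 1+n≢n (sym j≡1+j)
  ⇒-irrefl (even→odd _ (inj₂ j≡1+j)) = 1+n≢n (sym j≡1+j)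

  _≟_ : DecidableEquality Vertex
  _≟_ = ≡-dec Fin._≟_ Fin._≟_

  open Presentation +↔⊎ _⇒?_ ⇒-irrefl public
  open Ranking _⇒_
  open Recolouring _≟_ ⇒-irrefl

  parity-suc : ∀ x → parity (suc x) ≡ parity x ⁻¹
  parity-suc x = sym (ℙ.⁻¹-selfInverse (ℙ.suc-homo-⁻¹ x))

  parity-last : parity last ≡ 1ℙ
  parity-last = trans (parity-suc (2 * m)) (cong _⁻¹ (ℙ.*-homo-* 2 m))

  adjacent-parity : ∀ {x y} → Adjacent x y → parity y ≡ parity x ⁻¹
  adjacent-parity {x} (inj₁ refl) = parity-suc x
  adjacent-parity {y = y} (inj₂ refl) = sym (ℙ.suc-homo-⁻¹ y)

  even≢odd : ∀ {i j} → Even i → Odd j → toℕ i ≢ toℕ j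
  even≢odd i-even j-odd i≡j with () ← trans (sym i-even) (trans (cong parity i≡j) j-odd)

  spine-arc-parity : ∀ {i j} → spine i ⇒ spine j → Even i × Odd j
  spine-arc-parity (even→odd i-even adj) = i-even , trans (adjacent-parity adj) (cong _⁻¹ i-even)

  adjacent-inject₁-suc : ∀ (i : Fin last) → Adjacent (toℕ (inject₁ i)) (toℕ (suc i))
  adjacent-inject₁-suc i = inj₁ (cong suc (sym (toℕ-inject₁ i)))

  adjacent-arc : ∀ {i j} → Adjacent (toℕ i) (toℕ j) → spine i ⇒ spine j ⊎ spine j ⇒ spine i
  adjacent-arc {i} adj with parity (toℕ i) in i-parity
  ... | 0ℙ = inj₁ (even→odd i-parity adj)
  ... | 1ℙ = inj₂ (even→odd (trans (adjacent-parity adj) (cong _⁻¹ i-parity)) (Sum.swap adj))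

  walk-meets-hub : ∀ {x y z} → x ⇒ y → y ⇒ z → ∃[ t ] (hub t ≡ x ⊎ hub t ≡ y ⊎ hub t ≡ z)
  walk-meets-hub {hub t} _ _ = t , inj₁ refl
  walk-meets-hub {y = hub t} _ _ = t , inj₂ (inj₁ refl)
  walk-meets-hub {z = hub t} _ _ = t , inj₂ (inj₂ refl)
  walk-meets-hub {spine _} {spine j} {spine _} i⇒j j⇒l =
    ⊥-elim (even≢odd {j} (proj₁ (spine-arc-parity j⇒l)) (proj₂ (spine-arc-parity i⇒j)) refl)

  on-an-arc : ∀ x → ∃[ y ] (x ⇒ y ⊎ y ⇒ x)
  on-an-arc (hub zero) = h₁ , inj₁ (hub→hub λ ())
  on-an-arc (hub (suc t)) = h₀ , inj₁ (hub→hub λ ())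
  on-an-arc (spine j) with parity (toℕ j) in j-parity
  ... | 0ℙ = h₀ , inj₂ (low→even low₀ j-parity)
  ... | 1ℙ = h₀ , inj₁ (odd→low low₀ j-parity)

  many-vertices : m < n digraph
  many-vertices = ≤-trans (s≤s (≤-trans (m≤m+n m (m + 0)) (n≤1+n _))) (m≤n+m (suc last) h)

  spineRank : Vertex → ℕ
  spineRank (hub _) = 0
  spineRank (spine j) with parity (toℕ j)
  ... | 0ℙ = 0
  ... | 1ℙ = 1

  spine-arc-rank : ∀ {i j} → spine i ⇒ spine j → spineRank (spine i) < spineRank (spine j)
  spine-arc-rank i⇒j with spine-arc-parity i⇒j
  ... | i-even , j-odd rewrite i-even | j-odd = s≤s z≤n

  kColour : Vertex → Fin (suc h)
  kColour (hub t) = inject₁ t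
  kColour (spine _) = fromℕ h

  kColour-ranked : Ranked (λ _ _ → ⊤) kColour spineRank
  kColour-ranked {hub _} {hub _} (hub→hub s≢t) _ same = ⊥-elim (s≢t (inject₁-injective same))
  kColour-ranked {hub _} {spine _} _ _ same = ⊥-elim (fromℕ≢inject₁ (sym same))
  kColour-ranked {spine _} {hub _} _ _ same = ⊥-elim (fromℕ≢inject₁ same)
  kColour-ranked {spine _} {spine _} i⇒j _ _ = spine-arc-rank i⇒j

  k-dicolourable : Dicolourable (whole digraph) (suc h)
  k-dicolourable =
    ranked⇒dicolourable (whole digraph) {col = kColour} {r = spineRank} λ x⇒y _ → kColour-ranked x⇒y _

  spineColoured : Fin h → Vertex → Fin h
  spineColoured t (hub u) = u
  spineColoured t (spine _) = t

  spineColoured-ranked : ∀ t → Ranked (Avoiding (hub t)) (spineColoured t) spineRank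
  spineColoured-ranked t {hub _} {hub _} (hub→hub u≢v) _ same = ⊥-elim (u≢v same)
  spineColoured-ranked t {hub _} {spine _} _ (x≢t , _) same = ⊥-elim (x≢t (cong hub same))
  spineColoured-ranked t {spine _} {hub _} _ (_ , y≢t) same = ⊥-elim (y≢t (cong hub (sym same)))
  spineColoured-ranked t {spine _} {spine _} i⇒j _ _ = spine-arc-rank i⇒j

  hub-arc-removed : ∀ {s t} → hub s ⇒ hub t →
    Ranked (OtherThan (hub s) (hub t)) (spineColoured t [ hub t ≔ s ]) ((suc ∘ spineRank) [ hub t ≔ 0 ])
  hub-arc-removed {s} {t} (hub→hub s≢t) = recolour-source (spineColoured-ranked t) fresh
    where
    fresh : ∀ {x} → x ⇒ hub t → x ≢ hub s → spineColoured t x ≢ s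
    fresh {hub _} _ x≢s u≡s = x≢s (cong hub u≡s)
    fresh {spine _} _ _ t≡s = s≢t (sym t≡s)

  swapped : ℕ → ℕ → Parity
  swapped zero x = 1ℙ
  swapped (suc c) zero = 0ℙ
  swapped (suc c) (suc x) = swapped c x

  swapped-≥ : ∀ {c x} → c ≤ x → swapped c x ≡ 1ℙ
  swapped-≥ z≤n = refl
  swapped-≥ (s≤s c≤x) = swapped-≥ c≤x

  swapped-< : ∀ {c x} → x < c → swapped c x ≡ 0ℙ
  swapped-< {suc c} {zero} _ = refl
  swapped-< {suc c} {suc x} (s≤s x<c) = swapped-< x<c

  swapped-switch : ∀ c x → swapped c x ≡ swapped c (suc x) ⁻¹ → c ≡ suc x
  swapped-switch zero x ()
  swapped-switch (suc zero) zero _ = refl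
  swapped-switch (suc (suc c)) zero ()
  swapped-switch (suc c) (suc x) switch = cong suc (swapped-switch c x switch)

  -- The spine alternates between the colours of h₀ and h₁, swapped from position c on. The arcs
  -- then breaking the ranking are those of CutAt c: the spine arc joining positions c − 1 and c,
  -- and for c = 0 the arc s₀ → h₁.
  cutColour : ℕ → Vertex → Fin h
  cutColour c (hub t) = t
  cutColour c (spine j) = low (parity (toℕ j) ℙ.+ swapped c (toℕ j))

  cutRank : Vertex → ℕ
  cutRank (hub _) = 2
  cutRank (spine j) with parity (toℕ j)
  ... | 0ℙ = 3
  ... | 1ℙ = 1

  cutRank<4 : ∀ x → cutRank x < 4
  cutRank<4 (hub _) = s≤s (s≤s (s≤s z≤n))
  cutRank<4 (spine j) with parity (toℕ j)
  ... | 0ℙ = s≤s (s≤s (s≤s (s≤s z≤n)))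
  ... | 1ℙ = s≤s (s≤s z≤n)

  cutColour-h₀ : ∀ c j → parity (toℕ j) ≡ swapped c (toℕ j) → cutColour c (spine j) ≡ zero
  cutColour-h₀ c j agree =
    cong low (trans (cong (ℙ._+ swapped c (toℕ j)) agree) (ℙ.p+p≡0ℙ (swapped c (toℕ j))))

  low≢high : ∀ p {t} → low p ≢ suc (suc t)
  low≢high 0ℙ ()
  low≢high 1ℙ ()

  low-injective : ∀ {p q} → low p ≡ low q → p ≡ q
  low-injective {0ℙ} {0ℙ} _ = refl
  low-injective {1ℙ} {1ℙ} _ = refl

  data CutAt (c : ℕ) : Vertex → Vertex → Set where
    rising   : ∀ {i j} → toℕ j ≡ suc (toℕ i) → toℕ j ≡ c → CutAt c (spine i) (spine j)
    falling  : ∀ {i j} → toℕ i ≡ suc (toℕ j) → toℕ i ≡ c → CutAt c (spine i) (spine j)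
    first→h₁ : ∀ {j} → toℕ j ≡ 0 → c ≡ 0 → CutAt c (spine j) h₁

  adjacent-switch : ∀ c {x y} → Adjacent x y → swapped c x ≡ swapped c y ⁻¹ →
    (y ≡ suc x × y ≡ c) ⊎ (x ≡ suc y × x ≡ c)
  adjacent-switch c {x} (inj₁ refl) switch = inj₁ (refl , sym (swapped-switch c x switch))
  adjacent-switch c {y = y} (inj₂ refl) switch =
    inj₂ (refl , sym (swapped-switch c y (sym (ℙ.⁻¹-selfInverse (sym switch)))))

  spine-arc-cut : ∀ {c i j} → spine i ⇒ spine j →
    cutColour c (spine i) ≡ cutColour c (spine j) → CutAt c (spine i) (spine j)
  spine-arc-cut {c} {i} {j} i⇒j@(even→odd _ adj) same =
    Sum.[ Product.uncurry rising , Product.uncurry falling ] (adjacent-switch c adj switch)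
    where
    switch : swapped c (toℕ i) ≡ swapped c (toℕ j) ⁻¹
    switch with i-even , j-odd ← spine-arc-parity i⇒j =
      low-injective (subst₂ (λ p q → low (p ℙ.+ swapped c (toℕ i)) ≡ low (q ℙ.+ swapped c (toℕ j)))
                            i-even j-odd same)

  cut-ranked : ∀ {c x y} → c ≤ last → x ⇒ y → cutColour c x ≡ cutColour c y →
    cutRank x < cutRank y ⊎ CutAt c x y
  cut-ranked _ (hub→hub s≢t) same = ⊥-elim (s≢t same)
  cut-ranked _ (low→even _ j-even) _ rewrite j-even = inj₁ (s≤s (s≤s (s≤s z≤n)))
  cut-ranked _ (odd→low _ j-odd) _ rewrite j-odd = inj₁ (s≤s (s≤s z≤n))
  cut-ranked {c} c≤last (h₁→last {j} j≡last) same
    with () ← trans same (cutColour-h₀ c j (trans (trans (cong parity j≡last) parity-last)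
                                              (sym (swapped-≥ (subst (c ≤_) (sym j≡last) c≤last)))))
  cut-ranked {zero} _ (first→h₁ j≡0) _ = inj₂ (first→h₁ j≡0 refl)
  cut-ranked {suc c} _ (first→h₁ {j} j≡0) same
    with () ← trans (sym same)
                    (cutColour-h₀ (suc c) j (trans (cong parity j≡0) (cong (swapped (suc c)) (sym j≡0))))
  cut-ranked _ high→spine same = ⊥-elim (low≢high _ (sym same))
  cut-ranked _ spine→high same = ⊥-elim (low≢high _ same)
  cut-ranked _ i⇒j@(even→odd _ _) same = inj₂ (spine-arc-cut i⇒j same)

  cut-ranked-avoiding : ∀ z → Ranked (Avoiding (spine z)) (cutColour (toℕ z)) cutRank
  cut-ranked-avoiding z x⇒y (x≢z , y≢z) same with cut-ranked (toℕ≤pred[n] z) x⇒y same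
  ... | inj₁ increasing = increasing
  ... | inj₂ (rising _ j≡z) = ⊥-elim (y≢z (cong spine (toℕ-injective j≡z)))
  ... | inj₂ (falling _ i≡z) = ⊥-elim (x≢z (cong spine (toℕ-injective i≡z)))
  ... | inj₂ (first→h₁ i≡0 z≡0) = ⊥-elim (x≢z (cong spine (toℕ-injective (trans i≡0 (sym z≡0)))))

  into-last : ∀ {i z} → spine i ⇒ spine z → toℕ z ≡ last → toℕ i < toℕ z
  into-last (even→odd _ (inj₁ z≡1+i)) _ = ≤-reflexive (sym z≡1+i)
  into-last {i} (even→odd _ (inj₂ i≡1+z)) z≡last =
    ⊥-elim (n≮n last (subst (_≤ last) (trans i≡1+z (cong suc z≡last)) (toℕ≤pred[n] i)))

  in-neighbours-avoid-colour : ∀ {t z} → hub t ⇒ spine z →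
    ∀ {x} → x ⇒ spine z → x ≢ hub t → cutColour (toℕ z) x ≢ t
  in-neighbours-avoid-colour _ {hub _} _ x≢t s≡t = x≢t (cong hub s≡t)
  in-neighbours-avoid-colour {z = z} t⇒z {spine i} i⇒z _ with t⇒z | spine-arc-parity i⇒z
  ... | low→even _ z-even | _ , z-odd = ⊥-elim (even≢odd {z} z-even z-odd refl)
  ... | h₁→last z≡last | i-even , _ = λ same →
    0≢1+n (trans (sym (cutColour-h₀ (toℕ z) i (trans i-even (sym (swapped-< (into-last i⇒z z≡last)))))) same)
  ... | high→spine | _ = low≢high _

  out-neighbours-avoid-colour : ∀ {z t} → spine z ⇒ hub t →
    ∀ {y} → spine z ⇒ y → y ≢ hub t → cutColour (toℕ z) y ≢ t
  out-neighbours-avoid-colour _ {hub _} _ y≢t s≡t = y≢t (cong hub s≡t)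
  out-neighbours-avoid-colour {z} z⇒t {spine j} z⇒j _ with z⇒t | spine-arc-parity z⇒j
  ... | odd→low _ z-odd | z-even , _ = ⊥-elim (even≢odd {z} z-even z-odd refl)
  ... | first→h₁ z≡0 | _ , j-odd = λ same →
    0≢1+n (trans (sym (cutColour-h₀ (toℕ z) j (trans j-odd (cong (λ c → swapped c (toℕ j)) (sym z≡0))))) same)
  ... | spine→high | _ = low≢high _

  hub→spine-removed : ∀ {t z} → hub t ⇒ spine z →
    Ranked (OtherThan (hub t) (spine z)) (cutColour (toℕ z) [ spine z ≔ t ]) ((suc ∘ cutRank) [ spine z ≔ 0 ])
  hub→spine-removed {z = z} t⇒z =
    recolour-source (cut-ranked-avoiding z) (in-neighbours-avoid-colour t⇒z)

  spine→hub-removed : ∀ {z t} → spine z ⇒ hub t →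
    Ranked (OtherThan (spine z) (hub t)) (cutColour (toℕ z) [ spine z ≔ t ]) (cutRank [ spine z ≔ 4 ])
  spine→hub-removed {z} z⇒t =
    recolour-sink (cut-ranked-avoiding z) cutRank<4 (out-neighbours-avoid-colour z⇒t)

  CutAt-unique : ∀ {c i j x y} → spine i ⇒ spine j → CutAt c (spine i) (spine j) →
    x ⇒ y → CutAt c x y → x ≡ spine i × y ≡ spine j
  CutAt-unique _ (rising j≡1+i j≡c) _ (rising j′≡1+i′ j′≡c) =
    cong spine (toℕ-injective (suc-injective (trans (sym j′≡1+i′) (trans j′≡c (trans (sym j≡c) j≡1+i))))) ,
    cong spine (toℕ-injective (trans j′≡c (sym j≡c)))
  CutAt-unique _ (falling i≡1+j i≡c) _ (falling i′≡1+j′ i′≡c) =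
    cong spine (toℕ-injective (trans i′≡c (sym i≡c))) ,
    cong spine (toℕ-injective (suc-injective (trans (sym i′≡1+j′) (trans i′≡c (trans (sym i≡c) i≡1+j)))))
  CutAt-unique i⇒j (rising _ j≡c) x⇒y (falling _ i′≡c) =
    ⊥-elim (even≢odd (proj₁ (spine-arc-parity x⇒y)) (proj₂ (spine-arc-parity i⇒j)) (trans i′≡c (sym j≡c)))
  CutAt-unique i⇒j (falling _ i≡c) x⇒y (rising _ j′≡c) =
    ⊥-elim (even≢odd (proj₁ (spine-arc-parity i⇒j)) (proj₂ (spine-arc-parity x⇒y)) (trans i≡c (sym j′≡c)))
  CutAt-unique _ (rising j≡1+i j≡c) _ (first→h₁ _ c≡0) = ⊥-elim (1+n≢0 (trans (sym j≡1+i) (trans j≡c c≡0)))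
  CutAt-unique _ (falling i≡1+j i≡c) _ (first→h₁ _ c≡0) = ⊥-elim (1+n≢0 (trans (sym i≡1+j) (trans i≡c c≡0)))

  spine-arc-cutAt : ∀ {i j} → spine i ⇒ spine j → ∃[ c ] (c ≤ last × CutAt c (spine i) (spine j))
  spine-arc-cutAt {j = j} (even→odd _ (inj₁ j≡1+i)) = toℕ j , toℕ≤pred[n] j , rising j≡1+i refl
  spine-arc-cutAt {i} (even→odd _ (inj₂ i≡1+j)) = toℕ i , toℕ≤pred[n] i , falling i≡1+j refl

  spine-arc-removed : ∀ {i j} → spine i ⇒ spine j →
    ∃[ c ] Ranked (OtherThan (spine i) (spine j)) (cutColour c) cutRank
  spine-arc-removed i⇒j with c , c≤last , cut ← spine-arc-cutAt i⇒j =
    c , λ x⇒y other same →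
      Sum.[ id , (λ cut′ → ⊥-elim (other (CutAt-unique i⇒j cut x⇒y cut′))) ]′ (cut-ranked c≤last x⇒y same)

  removal-colouring : ∀ {p q} → p ⇒ q →
    ∃₂ λ (col : Vertex → Fin h) (r : Vertex → ℕ) → Ranked (OtherThan p q) col r
  removal-colouring {hub _} {hub _} p⇒q = _ , _ , hub-arc-removed p⇒q
  removal-colouring {hub _} {spine _} p⇒q = _ , _ , hub→spine-removed p⇒q
  removal-colouring {spine _} {hub _} p⇒q = _ , _ , spine→hub-removed p⇒q
  removal-colouring {spine _} {spine _} p⇒q with c , ranked ← spine-arc-removed p⇒q =
    cutColour c , cutRank , ranked

  proper-dicolourable : (H : SubDigraph digraph) → Proper H → Dicolourable H h
  proper-dicolourable H proper with p , q , p⇒q , pq∉H ← proper⇒missing-⇒ on-an-arc H proper =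
    rankedOtherThan⇒dicolourable H pq∉H (proj₂ (proj₂ (removal-colouring p⇒q)))

  module _ {J : ℕ} (dicolourable : Dicolourable (whole digraph) J) where

    colour : Vertex → Fin J
    colour x = colourOf dicolourable (Inverse.from +↔⊎ x)

    digon : ∀ {x y} → x ⇒ y → y ⇒ x → colour x ≢ colour y
    digon x⇒y y⇒x = digon-colours-differ dicolourable (⇒arc x⇒y) (⇒arc y⇒x)

    spine-arc-low-triangle : ∀ {t i j} → Low t → spine i ⇒ spine j →
      colour (spine i) ≡ colour (hub t) → colour (spine j) ≡ colour (hub t) → ⊥
    spine-arc-low-triangle lowT i⇒j i~t j~t with i-even , j-odd ← spine-arc-parity i⇒j =
      triangle-not-monochromatic dicolourable
        (⇒arc (low→even lowT i-even)) (⇒arc i⇒j) (⇒arc (odd→low lowT j-odd)) (sym i~t) (trans i~t (sym j~t))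

    adjacent-low-colours : ∀ {t i j} → Low t → Adjacent (toℕ i) (toℕ j) →
      colour (spine i) ≡ colour (hub t) → colour (spine j) ≡ colour (hub t) → ⊥
    adjacent-low-colours lowT adj i~t j~t with adjacent-arc adj
    ... | inj₁ i⇒j = spine-arc-low-triangle lowT i⇒j i~t j~t
    ... | inj₂ j⇒i = spine-arc-low-triangle lowT j⇒i j~t i~t

    spine-h₀-or-h₁ : J ≤ h → ∀ z → colour (spine z) ≡ colour h₀ ⊎ colour (spine z) ≡ colour h₁
    spine-h₀-or-h₁ J≤h z with pigeonhole (s≤s J≤h) palette
      where
      palette : Fin (suc h) → Fin J
      palette zero = colour (spine z)
      palette (suc t) = colour (hub t)
    ... | _ , zero , () , _
    ... | zero , suc zero , _ , z~h₀ = inj₁ z~h₀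
    ... | zero , suc (suc zero) , _ , z~h₁ = inj₂ z~h₁
    ... | zero , suc (suc (suc t)) , _ , z~high = ⊥-elim (digon spine→high high→spine z~high)
    ... | suc s , suc t , s<t , s~t =
      ⊥-elim (digon (hub→hub s≢t) (hub→hub (s≢t ∘ sym)) s~t)
      where s≢t : s ≢ t
            s≢t s≡t = <⇒≢ s<t (cong suc s≡t)

    spine-low-colour : J ≤ h → ∀ z q →
      colour (spine z) ≡ colour (hub (low q)) ⊎ colour (spine z) ≡ colour (hub (low (q ⁻¹)))
    spine-low-colour J≤h z 0ℙ = spine-h₀-or-h₁ J≤h z
    spine-low-colour J≤h z 1ℙ = Sum.swap (spine-h₀-or-h₁ J≤h z)

    alternating : J ≤ h → ∀ z → colour (spine z) ≡ colour (hub (low (parity (toℕ z))))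
    alternating J≤h = <-weakInduction P first next
      where
      P : Fin (suc last) → Set
      P z = colour (spine z) ≡ colour (hub (low (parity (toℕ z))))
      first : P zero
      first with spine-low-colour J≤h zero 0ℙ
      ... | inj₁ z~h₀ = z~h₀
      ... | inj₂ z~h₁ = ⊥-elim (digon (first→h₁ refl) (low→even low₁ refl) z~h₁)
      next : ∀ i → P (inject₁ i) → P (suc i)
      next i i~ with spine-low-colour J≤h (suc i) (parity (toℕ (inject₁ i)))
      ... | inj₁ i+1~ = ⊥-elim (adjacent-low-colours (Low-low _) (adjacent-inject₁-suc i) i~ i+1~)
      ... | inj₂ i+1~ =
        trans i+1~ (cong (colour ∘ hub ∘ low) (sym (adjacent-parity (adjacent-inject₁-suc i))))

    no-small-dicolouring : J ≤ h → ⊥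
    no-small-dicolouring J≤h = digon (h₁→last (toℕ-fromℕ last)) (odd→low low₁ last-odd) (sym last~h₁)
      where
      last-odd : Odd (fromℕ last)
      last-odd = trans (cong parity (toℕ-fromℕ last)) parity-last
      last~h₁ : colour (spine (fromℕ last)) ≡ colour h₁
      last~h₁ = trans (alternating J≤h (fromℕ last)) (cong (colour ∘ hub ∘ low) last-odd)

theorem2 : (k : ℕ) → k ≥ 3 → (N : ℕ) →
    ∃[ D ] (n D > N × Dicritical k D × ¬ HasDirectedPath (3 * k + 1) D)
theorem2 (suc (suc (suc a))) (s≤s (s≤s (s≤s z≤n))) N =
  digraph , many-vertices ,
  ((k-dicolourable , λ j j<k dicolourable → no-small-dicolouring dicolourable (≤-pred j<k)) ,
   λ H proper → h , ≤-refl , proper-dicolourable H proper) ,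
  ⇒-no-long-path hub walk-meets-hub (≤-trans (≤-reflexive (*-comm (suc h) 3)) (m≤m+n _ 1))
  where open Construction a N
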